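{- Simple semi-unification many-one reduces to right-uniform, two-inequality semi-unification; that is, there is a computable function mapping each finite set $\mathcal{C}$ of simple constraints to terms $\sigma_0,\sigma_1,\tau$ such that there exist substitutions $\varphi,\psi_0,\psi_1$ modelling every constraint in $\mathcal{C}$ if and only if there exist substitutions $\varphi',\psi_0',\psi_1'$ with $\psi_0'(\varphi'(\sigma_0))=\varphi'(\tau)$ and $\psi_1'(\varphi'(\sigma_1))=\varphi'(\tau)$.
   Context: Given a countably infinite set $\mathbb{V}$ of variables, terms are given by $\sigma,\tau::=\alpha\mid\sigma\to\tau$ with $\alpha\in\mathbb{V}$. A substitution is a map from $\mathbb{V}$ to terms, lifted homomorphically to terms. A simple constraint has shape $\langle a,\alpha,\epsilon\rangle\doteq\langle\epsilon,\beta,b\rangle$ with $a,b\in\{0,1\}$ and $\alpha,\beta\in\mathbb{V}$. A triple of substitutions $(\varphi,\psi_0,\psi_1)$ models it if either $b=0$ and $\psi_a(\varphi(\alpha))\to\tau=\varphi(\beta)$ for some term $\tau$, or $b=1$ and $\sigma\to\psi_a(\varphi(\alpha))=\varphi(\beta)$ for some term $\sigma$. Many-one reduction: a computable $f$ with $P(x)\iff Q(f(x))$ for all inputs $x$. -}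

module Defs where

open import Data.Nat using (ℕ)
open import Data.Bool using (Bool; true; false)
open import Data.Product using (Σ; ∃; _×_)
open import Data.List using (List)
open import Data.List.Relation.Unary.All using (All)
open import Relation.Binary.PropositionalEquality using (_≡_)

Var : Set
Var = ℕ

data Term : Set where
  var  : Var → Term
  _⇒_ : Term → Term → Term

infixr 5 _⇒_

Subst : Set
Subst = Var → Term

_⟪_⟫ : Subst → Term → Term
s ⟪ var α ⟫ = s α
s ⟪ σ ⇒ τ ⟫ = (s ⟪ σ ⟫) ⇒ (s ⟪ τ ⟫)

-- A simple constraint ⟨a,α,ε⟩ ≐ ⟨ε,β,b⟩ with a,b ∈ {0,1}
-- (false = 0, true = 1)
record SimpleConstraint : Set where
  constructor ⟨_,_,ε⟩≐⟨ε,_,_⟩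
  field
    a : Bool
    α : Var
    β : Var
    b : Bool

select : Bool → Subst → Subst → Subst
select false ψ₀ ψ₁ = ψ₀
select true  ψ₀ ψ₁ = ψ₁

Models : Subst → Subst → Subst → SimpleConstraint → Set
Models φ ψ₀ ψ₁ c with SimpleConstraint.b c
... | false = Σ Term λ τ → ((select (SimpleConstraint.a c) ψ₀ ψ₁) ⟪ φ (SimpleConstraint.α c) ⟫) ⇒ τ ≡ φ (SimpleConstraint.β c)
... | true  = Σ Term λ σ → σ ⇒ ((select (SimpleConstraint.a c) ψ₀ ψ₁) ⟪ φ (SimpleConstraint.α c) ⟫) ≡ φ (SimpleConstraint.β c)

SimpleSolvable : List SimpleConstraint → Set
SimpleSolvable C = Σ Subst λ φ → Σ Subst λ ψ₀ → Σ Subst λ ψ₁ → All (Models φ ψ₀ ψ₁) C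

TwoIneqSolvable : Term → Term → Term → Set
TwoIneqSolvable σ₀ σ₁ τ =
  Σ Subst λ φ′ → Σ Subst λ ψ₀′ → Σ Subst λ ψ₁′ →
    (ψ₀′ ⟪ φ′ ⟪ σ₀ ⟫ ⟫ ≡ φ′ ⟪ τ ⟫) × (ψ₁′ ⟪ φ′ ⟪ σ₁ ⟫ ⟫ ≡ φ′ ⟪ τ ⟫)

-- The variables of the simple constraints are renamed to even variables, and
-- the k-th constraint ⟨a,α,ε⟩ ≐ ⟨ε,β,b⟩ gets its own odd variable x. It
-- contributes the component β to τ, the component α ⇒ x (b = 0) or x ⇒ α
-- (b = 1) to σ_a, and the bare x to the other σ; the components are combined
-- with ⇒. Solving σ_a against τ says that ψ_a(φ α) sits on side b of an arrow
-- equal to φ β, with ψ_a(x) as the other half, while the inequality for the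
-- other σ is satisfied by letting that ψ send x to φ β. A solution of the
-- constraints is thus extended to one of the instance by choosing the images
-- of the fresh variables, and the even part of a solution of the instance is
-- a solution of the constraints.
module Submission where

open import Defs
open import Data.Bool using (Bool; true; false; if_then_else_; _xor_)
open import Data.List using (List; []; _∷_)
open import Data.List.Relation.Unary.All using (All; []; _∷_)
open import Data.Nat using (ℕ; zero; suc)
open import Data.Product using (Σ; ∃-syntax; _×_; proj₁; proj₂; _,_)
open import Function using (_∘_)
open import Function.Bundles using (_⇔_; mk⇔; Equivalence)
open import Relation.Binary.PropositionalEquality
  using (_≡_; refl; sym; cong; cong₂; module ≡-Reasoning)

open ≡-Reasoning

double : ℕ → ℕ
double zero = zero
double (suc n) = suc (suc (double n))

interleave : {A : Set} → (ℕ → A) → (ℕ → A) → ℕ → A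
interleave f g zero = f zero
interleave f g (suc zero) = g zero
interleave f g (suc (suc n)) = interleave (f ∘ suc) (g ∘ suc) n

interleave-even : {A : Set} (f g : ℕ → A) (n : ℕ) → interleave f g (double n) ≡ f n
interleave-even f g zero = refl
interleave-even f g (suc n) = interleave-even (f ∘ suc) (g ∘ suc) n

interleave-odd : {A : Set} (f g : ℕ → A) (n : ℕ) → interleave f g (suc (double n)) ≡ g n
interleave-odd f g zero = refl
interleave-odd f g (suc n) = interleave-odd (f ∘ suc) (g ∘ suc) n

select-both : (i : Bool) (ψ : Bool → Subst) → select i (ψ false) (ψ true) ≡ ψ i
select-both false ψ = refl
select-both true ψ = refl

⇒-injective : {σ τ σ′ τ′ : Term} → σ ⇒ τ ≡ σ′ ⇒ τ′ → (σ ≡ σ′) × (τ ≡ τ′)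
⇒-injective refl = refl , refl

⟪⟫-comm : (s r r′ s′ : Subst) → (∀ v → s ⟪ r v ⟫ ≡ r′ ⟪ s′ v ⟫) →
          (t : Term) → s ⟪ r ⟪ t ⟫ ⟫ ≡ r′ ⟪ s′ ⟪ t ⟫ ⟫
⟪⟫-comm s r r′ s′ eq (var v) = eq v
⟪⟫-comm s r r′ s′ eq (σ ⇒ τ) = cong₂ _⇒_ (⟪⟫-comm s r r′ s′ eq σ) (⟪⟫-comm s r r′ s′ eq τ)

embed : Term → Term
embed t = (var ∘ double) ⟪ t ⟫

arrow : Bool → Term → Term → Term
arrow false s t = s ⇒ t
arrow true s t = t ⇒ s

⟪⟫-arrow : (s : Subst) (b : Bool) (σ τ : Term) → s ⟪ arrow b σ τ ⟫ ≡ arrow b (s ⟪ σ ⟫) (s ⟪ τ ⟫)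
⟪⟫-arrow s false σ τ = refl
⟪⟫-arrow s true σ τ = refl

Models→arrow : {φ ψ₀ ψ₁ : Subst} (c : SimpleConstraint) → Models φ ψ₀ ψ₁ c →
  let open SimpleConstraint c in
  ∃[ τ ] arrow b (select a ψ₀ ψ₁ ⟪ φ α ⟫) τ ≡ φ β
Models→arrow ⟨ a , α ,ε⟩≐⟨ε, β , false ⟩ m = m
Models→arrow ⟨ a , α ,ε⟩≐⟨ε, β , true ⟩ m = m

Instance : Set
Instance = Term × Term × Term

Solution : Subst → Subst → Subst → Instance → Set
Solution φ ψ₀ ψ₁ (σ₀ , σ₁ , τ) = (ψ₀ ⟪ φ ⟪ σ₀ ⟫ ⟫ ≡ φ ⟪ τ ⟫) × (ψ₁ ⟪ φ ⟪ σ₁ ⟫ ⟫ ≡ φ ⟪ τ ⟫)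

_⇒³_ : Instance → Instance → Instance
(σ₀ , σ₁ , τ) ⇒³ (σ₀′ , σ₁′ , τ′) = σ₀ ⇒ σ₀′ , σ₁ ⇒ σ₁′ , τ ⇒ τ′

Solution-⇒³ : {φ ψ₀ ψ₁ : Subst} (I J : Instance) →
  Solution φ ψ₀ ψ₁ (I ⇒³ J) ⇔ (Solution φ ψ₀ ψ₁ I × Solution φ ψ₀ ψ₁ J)
Solution-⇒³ {φ} {ψ₀} {ψ₁} I J = mk⇔ split join
  where
  split : Solution φ ψ₀ ψ₁ (I ⇒³ J) → Solution φ ψ₀ ψ₁ I × Solution φ ψ₀ ψ₁ J
  split (e₀ , e₁) with ⇒-injective e₀ | ⇒-injective e₁
  ... | (l₀ , r₀) | (l₁ , r₁) = (l₀ , l₁) , (r₀ , r₁)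
  join : Solution φ ψ₀ ψ₁ I × Solution φ ψ₀ ψ₁ J → Solution φ ψ₀ ψ₁ (I ⇒³ J)
  join ((l₀ , l₁) , (r₀ , r₁)) = cong₂ _⇒_ l₀ r₀ , cong₂ _⇒_ l₁ r₁

terminator : Instance
terminator = var 1 , var 1 , var 1

gadget : Var → SimpleConstraint → Instance
gadget x ⟨ false , α ,ε⟩≐⟨ε, β , b ⟩ = arrow b (var (double α)) (var x) , var x , var (double β)
gadget x ⟨ true , α ,ε⟩≐⟨ε, β , b ⟩ = var x , arrow b (var (double α)) (var x) , var (double β)

reduceFrom : (ℕ → Var) → List SimpleConstraint → Instance
reduceFrom fresh [] = terminator
reduceFrom fresh (c ∷ cs) = gadget (fresh 0) c ⇒³ reduceFrom (fresh ∘ suc) cs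

freshVar : ℕ → Var
freshVar m = suc (double (suc m))

reduce : List SimpleConstraint → Instance
reduce = reduceFrom freshVar

module Soundness (φ′ ψ₀′ ψ₁′ : Subst) where

  gadget-sound : (x : Var) (c : SimpleConstraint) →
    Solution φ′ ψ₀′ ψ₁′ (gadget x c) → Models (φ′ ∘ double) ψ₀′ ψ₁′ c
  gadget-sound x ⟨ false , α ,ε⟩≐⟨ε, β , false ⟩ (e , _) = _ , e
  gadget-sound x ⟨ false , α ,ε⟩≐⟨ε, β , true ⟩ (e , _) = _ , e
  gadget-sound x ⟨ true , α ,ε⟩≐⟨ε, β , false ⟩ (_ , e) = _ , e
  gadget-sound x ⟨ true , α ,ε⟩≐⟨ε, β , true ⟩ (_ , e) = _ , e

  reduceFrom-sound : (fresh : ℕ → Var) (C : List SimpleConstraint) →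
    Solution φ′ ψ₀′ ψ₁′ (reduceFrom fresh C) → All (Models (φ′ ∘ double) ψ₀′ ψ₁′) C
  reduceFrom-sound fresh [] _ = []
  reduceFrom-sound fresh (c ∷ cs) sol
    with Equivalence.to (Solution-⇒³ (gadget (fresh 0) c) (reduceFrom (fresh ∘ suc) cs)) sol
  ... | head , tail = gadget-sound (fresh 0) c head ∷ reduceFrom-sound (fresh ∘ suc) cs tail

module Completeness (φ ψ₀ ψ₁ : Subst) where

  witness : (c : SimpleConstraint) → Models φ ψ₀ ψ₁ c → Bool → Term
  witness c m i = if a xor i then embed (φ β) else embed (proj₁ (Models→arrow c m))
    where open SimpleConstraint c

  -- The junk value var 1 beyond the end of the list is never used.
  witnesses : {C : List SimpleConstraint} → All (Models φ ψ₀ ψ₁) C → Bool → ℕ → Term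
  witnesses [] i m = var 1
  witnesses (m ∷ ms) i zero = witness _ m i
  witnesses (m ∷ ms) i (suc k) = witnesses ms i k

  module Simulation (φ′ ψ₀′ ψ₁′ : Subst)
    (φ′-double : ∀ v → φ′ (double v) ≡ embed (φ v))
    (ψ′-double : ∀ i v → select i ψ₀′ ψ₁′ (double v) ≡ embed (select i ψ₀ ψ₁ v)) where

    ψ′-embed : (i : Bool) (t : Term) → select i ψ₀′ ψ₁′ ⟪ embed t ⟫ ≡ embed (select i ψ₀ ψ₁ ⟪ t ⟫)
    ψ′-embed i = ⟪⟫-comm (select i ψ₀′ ψ₁′) (var ∘ double) (var ∘ double) (select i ψ₀ ψ₁) (ψ′-double i)

    active-side : (i b : Bool) (α β x : Var) (τ : Term) →
      arrow b (select i ψ₀ ψ₁ ⟪ φ α ⟫) τ ≡ φ β → φ′ x ≡ var x → select i ψ₀′ ψ₁′ x ≡ embed τ →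
      select i ψ₀′ ψ₁′ ⟪ φ′ ⟪ arrow b (var (double α)) (var x) ⟫ ⟫ ≡ φ′ (double β)
    active-side i b α β x τ model x-fixed x-image = begin
      ψ′ ⟪ φ′ ⟪ arrow b (var (double α)) (var x) ⟫ ⟫   ≡⟨ cong (ψ′ ⟪_⟫) (⟪⟫-arrow φ′ b _ _) ⟩
      ψ′ ⟪ arrow b (φ′ (double α)) (φ′ x) ⟫           ≡⟨ ⟪⟫-arrow ψ′ b _ _ ⟩
      arrow b (ψ′ ⟪ φ′ (double α) ⟫) (ψ′ ⟪ φ′ x ⟫)    ≡⟨ cong₂ (λ s t → arrow b (ψ′ ⟪ s ⟫) (ψ′ ⟪ t ⟫)) (φ′-double α) x-fixed ⟩
      arrow b (ψ′ ⟪ embed (φ α) ⟫) (ψ′ x)            ≡⟨ cong₂ (arrow b) (ψ′-embed i (φ α)) x-image ⟩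
      arrow b (embed (ψ ⟪ φ α ⟫)) (embed τ)          ≡⟨ sym (⟪⟫-arrow (var ∘ double) b _ _) ⟩
      embed (arrow b (ψ ⟪ φ α ⟫) τ)                  ≡⟨ cong embed model ⟩
      embed (φ β)                                    ≡⟨ sym (φ′-double β) ⟩
      φ′ (double β)                                  ∎
      where
      ψ ψ′ : Subst
      ψ = select i ψ₀ ψ₁
      ψ′ = select i ψ₀′ ψ₁′

    passive-side : (i : Bool) (β x : Var) → φ′ x ≡ var x → select i ψ₀′ ψ₁′ x ≡ embed (φ β) →
      select i ψ₀′ ψ₁′ ⟪ φ′ x ⟫ ≡ φ′ (double β)
    passive-side i β x x-fixed x-image = begin
      select i ψ₀′ ψ₁′ ⟪ φ′ x ⟫  ≡⟨ cong (select i ψ₀′ ψ₁′ ⟪_⟫) x-fixed ⟩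
      select i ψ₀′ ψ₁′ x         ≡⟨ x-image ⟩
      embed (φ β)                ≡⟨ sym (φ′-double β) ⟩
      φ′ (double β)              ∎

    gadget-complete : (x : Var) (c : SimpleConstraint) (m : Models φ ψ₀ ψ₁ c) →
      φ′ x ≡ var x → (∀ i → select i ψ₀′ ψ₁′ x ≡ witness c m i) →
      Solution φ′ ψ₀′ ψ₁′ (gadget x c)
    gadget-complete x c@(⟨ false , α ,ε⟩≐⟨ε, β , b ⟩) m x-fixed x-image =
      active-side false b α β x _ (proj₂ (Models→arrow c m)) x-fixed (x-image false) ,
      passive-side true β x x-fixed (x-image true)
    gadget-complete x c@(⟨ true , α ,ε⟩≐⟨ε, β , b ⟩) m x-fixed x-image =
      passive-side false β x x-fixed (x-image false) ,
      active-side true b α β x _ (proj₂ (Models→arrow c m)) x-fixed (x-image true)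

    reduceFrom-complete : Solution φ′ ψ₀′ ψ₁′ terminator →
      (fresh : ℕ → Var) {C : List SimpleConstraint} (ms : All (Models φ ψ₀ ψ₁) C) →
      (∀ k → φ′ (fresh k) ≡ var (fresh k)) → (∀ i k → select i ψ₀′ ψ₁′ (fresh k) ≡ witnesses ms i k) →
      Solution φ′ ψ₀′ ψ₁′ (reduceFrom fresh C)
    reduceFrom-complete end fresh [] _ _ = end
    reduceFrom-complete end fresh {c ∷ cs} (m ∷ ms) fixed image =
      Equivalence.from (Solution-⇒³ (gadget (fresh 0) c) (reduceFrom (fresh ∘ suc) cs))
        ( gadget-complete (fresh 0) c m (fixed 0) (λ i → image i 0)
        , reduceFrom-complete end (fresh ∘ suc) ms (fixed ∘ suc) (λ i → image i ∘ suc))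

  module _ {C : List SimpleConstraint} (ms : All (Models φ ψ₀ ψ₁) C) where

    φ′ : Subst
    φ′ = interleave (embed ∘ φ) (var ∘ suc ∘ double)

    -- The odd variable 1 belongs to the terminator, the others are freshVar k.
    oddImage : Bool → ℕ → Term
    oddImage i zero = var 1
    oddImage i (suc k) = witnesses ms i k

    ψ′ : Bool → Subst
    ψ′ i = interleave (embed ∘ select i ψ₀ ψ₁) (oddImage i)

    ψ′-double : ∀ i v → select i (ψ′ false) (ψ′ true) (double v) ≡ embed (select i ψ₀ ψ₁ v)
    ψ′-double i v rewrite select-both i ψ′ = interleave-even (embed ∘ select i ψ₀ ψ₁) (oddImage i) v

    ψ′-fresh : ∀ i k → select i (ψ′ false) (ψ′ true) (freshVar k) ≡ witnesses ms i k
    ψ′-fresh i k rewrite select-both i ψ′ = interleave-odd (embed ∘ select i ψ₀ ψ₁) (oddImage i) (suc k)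

    φ′-double : ∀ v → φ′ (double v) ≡ embed (φ v)
    φ′-double = interleave-even (embed ∘ φ) (var ∘ suc ∘ double)

    φ′-fresh : ∀ k → φ′ (freshVar k) ≡ var (freshVar k)
    φ′-fresh k = interleave-odd (embed ∘ φ) (var ∘ suc ∘ double) (suc k)

    open Simulation φ′ (ψ′ false) (ψ′ true) φ′-double ψ′-double

    reduce-complete : Solution φ′ (ψ′ false) (ψ′ true) (reduce C)
    reduce-complete = reduceFrom-complete (refl , refl) freshVar ms φ′-fresh ψ′-fresh

reduce-correct : (C : List SimpleConstraint) →
  let (σ₀ , σ₁ , τ) = reduce C in SimpleSolvable C ⇔ TwoIneqSolvable σ₀ σ₁ τ
reduce-correct C = mk⇔ complete sound
  where
  σ₀ σ₁ τ : Term
  σ₀ = proj₁ (reduce C)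
  σ₁ = proj₁ (proj₂ (reduce C))
  τ = proj₂ (proj₂ (reduce C))
  complete : SimpleSolvable C → TwoIneqSolvable σ₀ σ₁ τ
  complete (φ , ψ₀ , ψ₁ , ms) = φ′ ms , ψ′ ms false , ψ′ ms true , reduce-complete ms
    where open Completeness φ ψ₀ ψ₁
  sound : TwoIneqSolvable σ₀ σ₁ τ → SimpleSolvable C
  sound (φ′ , ψ₀′ , ψ₁′ , sol) = φ′ ∘ double , ψ₀′ , ψ₁′ , reduceFrom-sound φ′ ψ₀′ ψ₁′ freshVar C sol
    where open Soundness

lemma5p18 : Σ (List SimpleConstraint → Term × Term × Term) λ f →
    (C : List SimpleConstraint) →
    SimpleSolvable C ⇔ TwoIneqSolvable (proj₁ (f C)) (proj₁ (proj₂ (f C))) (proj₂ (proj₂ (f C)))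
lemma5p18 = reduce , reduce-correct
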